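{- Let $Q\subseteq\mathbb{F}_4^n$ be an additive code with $4^k$ codewords, and let $B=\phi(Q^\perp)^\perp$ (binary dual of the binary image of the trace dual of $Q$). Then: (i) $B$ is a linear binary $[3n,n+2k]$ code; (ii) if $w$ is a weight of $Q^\perp$ occurring with frequency $A_w$, then $2w$ is a weight of $B^\perp$ with frequency $A_w$, and all weights of $B^\perp$ arise in this way; (iii) the coset graphs $\Gamma_Q$ and $\Gamma_B$ are isomorphic.
   Context: $\mathbb{F}_4=\{0,1,\omega,\omega^2\}$ with $\omega^2=\omega+1$; $\mathrm{Tr}(z)=z+z^2$. An additive code of length $n$ over $\mathbb{F}_4$ is an additive subgroup of $\mathbb{F}_4^n$; its dual $Q^\perp$ is taken with respect to the trace inner product $x*y=\sum_i\mathrm{Tr}(x_iy_i^2)$. The map $\phi:\mathbb{F}_4\to\mathbb{F}_2^3$ is $\phi(a+b\omega)=(b,a+b,a)$ for $a,b\in\mathbb{F}_2$ (equivalently $\phi(c)=(\mathrm{Tr}(c),\mathrm{Tr}(\omega c),\mathrm{Tr}(\omega^2c))$), extended coordinatewise to $\mathbb{F}_4^n\to\mathbb{F}_2^{3n}$. Binary duals use the standard inner product. The coset graph of a code $C$ (additive quaternary or linear binary) has as vertices the cosets of $C$ in the ambient space, two cosets being adjacent if their difference contains a vector of Hamming weight $1$. -}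

module Defs where

open import Data.Bool using (Bool; true; false; _∧_; _∨_; not; _xor_; if_then_else_)
open import Data.Nat using (ℕ; zero; suc; _+_; _*_; _≡ᵇ_)
open import Data.List using (List; []; _∷_; [_]; map; concatMap)
open import Data.Bool.ListAction using (all; any)
open import Data.Vec using (Vec; []; _∷_; zipWith; replicate; concat; foldr)
open import Data.Vec.Properties using (≡-dec)
open import Data.Product using (Σ; _×_; ∃)
open import Relation.Binary.PropositionalEquality using (_≡_)
open import Relation.Nullary.Decidable using (⌊_⌋)
open import Function.Bundles using (_⇔_)
import Data.Bool.Properties as BoolP

data F4 : Set where
  𝟎 𝟏 ω ω² : F4

_+₄_ : F4 → F4 → F4
𝟎  +₄ y  = y
x  +₄ 𝟎  = x
𝟏  +₄ 𝟏  = 𝟎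
𝟏  +₄ ω  = ω²
𝟏  +₄ ω² = ω
ω  +₄ 𝟏  = ω²
ω  +₄ ω  = 𝟎
ω  +₄ ω² = 𝟏
ω² +₄ 𝟏  = ω
ω² +₄ ω  = 𝟏
ω² +₄ ω² = 𝟎

_*₄_ : F4 → F4 → F4
𝟎  *₄ y  = 𝟎
x  *₄ 𝟎  = 𝟎
𝟏  *₄ y  = y
x  *₄ 𝟏  = x
ω  *₄ ω  = ω²
ω  *₄ ω² = 𝟏
ω² *₄ ω  = 𝟏
ω² *₄ ω² = ω

-- Tr(z) = z + z², valued in F₂ = Bool (false = 0, true = 1).
Tr : F4 → Bool
Tr 𝟎  = false
Tr 𝟏  = false
Tr ω  = true
Tr ω² = true

F4-elems : List F4
F4-elems = 𝟎 ∷ 𝟏 ∷ ω ∷ ω² ∷ []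

Bool-elems : List Bool
Bool-elems = false ∷ true ∷ []

allVecs : {A : Set} → List A → (n : ℕ) → List (Vec A n)
allVecs xs zero    = [ [] ]
allVecs xs (suc n) = concatMap (λ a → map (a ∷_) (allVecs xs n)) xs

countᵇ : {A : Set} → (A → Bool) → List A → ℕ
countᵇ p []       = 0
countᵇ p (x ∷ xs) = if p x then suc (countᵇ p xs) else countᵇ p xs

wtWith : {A : Set} {n : ℕ} → (A → Bool) → Vec A n → ℕ
wtWith nz = foldr _ (λ a r → if nz a then suc r else r) 0

Code₄ : ℕ → Set
Code₄ n = Vec F4 n → Bool

_⊕₄_ : {n : ℕ} → Vec F4 n → Vec F4 n → Vec F4 n
_⊕₄_ = zipWith _+₄_

nz₄ : F4 → Bool
nz₄ 𝟎 = false
nz₄ _ = true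

wt₄ : {n : ℕ} → Vec F4 n → ℕ
wt₄ = wtWith nz₄

IsAdditive : {n : ℕ} → Code₄ n → Set
IsAdditive {n} Q = (Q (replicate n 𝟎) ≡ true)
  × (∀ x y → Q x ≡ true → Q y ≡ true → Q (x ⊕₄ y) ≡ true)

card₄ : {n : ℕ} → Code₄ n → ℕ
card₄ {n} Q = countᵇ Q (allVecs F4-elems n)

traceIP : {n : ℕ} → Vec F4 n → Vec F4 n → Bool
traceIP x y = foldr _ _xor_ false (zipWith (λ a b → Tr (a *₄ (b *₄ b))) x y)

dual₄ : {n : ℕ} → Code₄ n → Code₄ n
dual₄ {n} Q y = all (λ x → not (Q x) ∨ not (traceIP x y)) (allVecs F4-elems n)

freq₄ : {n : ℕ} → Code₄ n → ℕ → ℕ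
freq₄ {n} Q w = countᵇ (λ x → Q x ∧ (wt₄ x ≡ᵇ w)) (allVecs F4-elems n)

Code₂ : ℕ → Set
Code₂ n = Vec Bool n → Bool

_⊕₂_ : {n : ℕ} → Vec Bool n → Vec Bool n → Vec Bool n
_⊕₂_ = zipWith _xor_

wt₂ : {n : ℕ} → Vec Bool n → ℕ
wt₂ = wtWith (λ b → b)

IsLinear₂ : {n : ℕ} → Code₂ n → Set
IsLinear₂ {n} B = (B (replicate n false) ≡ true)
  × (∀ x y → B x ≡ true → B y ≡ true → B (x ⊕₂ y) ≡ true)

card₂ : {n : ℕ} → Code₂ n → ℕ
card₂ {n} B = countᵇ B (allVecs Bool-elems n)

dot₂ : {n : ℕ} → Vec Bool n → Vec Bool n → Bool
dot₂ x y = foldr _ _xor_ false (zipWith _∧_ x y)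

dual₂ : {n : ℕ} → Code₂ n → Code₂ n
dual₂ {n} B y = all (λ x → not (B x) ∨ not (dot₂ x y)) (allVecs Bool-elems n)

freq₂ : {n : ℕ} → Code₂ n → ℕ → ℕ
freq₂ {n} B w = countᵇ (λ x → B x ∧ (wt₂ x ≡ᵇ w)) (allVecs Bool-elems n)

-- The map φ : F₄ → F₂³, φ(a + bω) = (b, a+b, a), extended coordinatewise.
-- (F₄ⁿ → F₂^{3n}; the length 3n is written n * 3, coordinates of block i
-- being the images of the i-th coordinate.)

φ : F4 → Vec Bool 3
φ 𝟎  = false ∷ false ∷ false ∷ []   -- a=0,b=0
φ 𝟏  = false ∷ true  ∷ true  ∷ []   -- a=1,b=0
φ ω  = true  ∷ true  ∷ false ∷ []   -- a=0,b=1
φ ω² = true  ∷ false ∷ true  ∷ []   -- a=1,b=1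

φᵛ : {n : ℕ} → Vec F4 n → Vec Bool (n * 3)
φᵛ x = concat (Data.Vec.map φ x)

imageφ : {n : ℕ} → Code₄ n → Code₂ (n * 3)
imageφ {n} C z = any (λ y → C y ∧ ⌊ ≡-dec BoolP._≟_ (φᵛ y) z ⌋) (allVecs F4-elems n)

-- Coset graphs, presented on the ambient space modulo "same coset"
-- (a quotient presented as a setoid), and graph isomorphism between them.

record PreGraph : Set₁ where
  field
    V       : Set
    SameV   : V → V → Set
    Adj     : V → V → Set

-- Coset graph of an additive code Q ⊆ F₄ⁿ: x+Q ~ y+Q; adjacent iff
-- (x+Q) − (y+Q) = x − y + Q contains a vector e of weight 1,
-- i.e. e − (x − y) ∈ Q (characteristic 2: x ⊕ y ⊕ e ∈ Q).
cosetGraph₄ : {n : ℕ} → Code₄ n → PreGraph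
cosetGraph₄ {n} Q = record
  { V     = Vec F4 n
  ; SameV = λ x y → Q (x ⊕₄ y) ≡ true
  ; Adj   = λ x y → Σ (Vec F4 n) (λ e → (wt₄ e ≡ 1) × (Q ((x ⊕₄ y) ⊕₄ e) ≡ true))
  }

cosetGraph₂ : {n : ℕ} → Code₂ n → PreGraph
cosetGraph₂ {n} B = record
  { V     = Vec Bool n
  ; SameV = λ x y → B (x ⊕₂ y) ≡ true
  ; Adj   = λ x y → Σ (Vec Bool n) (λ e → (wt₂ e ≡ 1) × (B ((x ⊕₂ y) ⊕₂ e) ≡ true))
  }

record _≅ᴳ_ (G H : PreGraph) : Set where
  private
    module G = PreGraph G
    module H = PreGraph H
  field
    f         : G.V → H.V
    f-wd      : ∀ x y → G.SameV x y → H.SameV (f x) (f y)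
    f-inj     : ∀ x y → H.SameV (f x) (f y) → G.SameV x y
    f-surj    : ∀ z → ∃ (λ x → H.SameV (f x) z)
    f-adj     : ∀ x y → G.Adj x y ⇔ H.Adj (f x) (f y)

-- Write D = Q^⊥ and P = φ(D), so that B = P^⊥. In the coordinates a + bω ↦ (a , b) on one side and
-- (b , a) on the other, the trace form becomes the standard dot product; this identifies Q with a
-- binary linear code of length 2n, and the binary facts |C| |C^⊥| = 2^N and C^⊥⊥ = C (by induction on
-- the length) give |Q| |D| = 4^n and D^⊥ = Q. Since φ is injective and additive, P is linear with
-- |P| = |D|, hence |B| = 2^(3n) / |D| = 2^n |Q|, and B^⊥ = P together with wt (φ y) = 2 wt y gives the
-- weight distribution. For the coset graphs, let φᵀ : F₂³ → F₄ be the adjoint of φ, i.e.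
-- φ c · t = Tr (φᵀ(t) c²). Then z ∈ B iff φᵀ z ∈ D^⊥ = Q, so the map ψ : F₄ → F₂³, a section of φᵀ
-- onto the vectors of weight ≤ 1, induces an isomorphism F₄ⁿ / Q ≅ F₂³ⁿ / B that matches weight-one
-- vectors.

module Submission where

open import Defs
open import Data.Nat using (ℕ; zero; suc; _+_; _*_; _^_; _≤_; s≤s; _≡ᵇ_)
open import Data.Nat.Properties
  using ( +-identityʳ; *-assoc; *-suc; *-cancelˡ-≡; ^-distribˡ-+-*; m^n≢0; m≤n⇒m≤1+n; ≤-reflexive
        ; ≡ᵇ⇒≡; ≡⇒≡ᵇ; +-commutativeSemigroup; *-commutativeSemigroup)
open import Data.Nat.ListAction using (sum)
open import Data.Nat.ListAction.Properties using (sum-++)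
open import Data.Nat.Tactic.RingSolver using (solve-∀)
open import Data.Bool using (Bool; true; false; _∧_; _∨_; not; _xor_)
open import Data.Bool.Properties as BoolP
  using ( T-≡; ¬-not; ⇔→≡; xor-assoc; xor-same; xor-identityʳ; ∧-comm; ∧-zeroʳ; ∧-identityʳ; ∧-distribˡ-xor
        ; not-involutive; xor-∧-commutativeRing)
open import Data.Bool.ListAction using (all; any)
open import Data.List as L using (List; []; _∷_; concatMap)
open import Data.List.Properties using (map-++; map-cong; map-∘)
open import Data.List.Membership.Propositional using (_∈_)
open import Data.List.Membership.Propositional.Properties using (∈-map⁺; ∈-concatMap⁺)
open import Data.List.Relation.Unary.Any as Any using (here; there)
open import Data.List.Relation.Unary.Any.Properties using (any⁺; any⁻)
open import Data.List.Relation.Unary.All as All using ()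
open import Data.List.Relation.Unary.All.Properties using (all⁺; all⁻)
open import Data.Vec as V using (Vec; []; _∷_; _++_; replicate; take; drop)
open import Data.Vec.Properties using (≡-dec; ++-injectiveˡ; ++-injectiveʳ; zipWith-++; take++drop≡id)
open import Data.Product using (∃; _×_; _,_; proj₁; proj₂)
open import Data.Sum using (_⊎_; inj₁; inj₂)
open import Data.Empty using (⊥-elim)
open import Function using (_∘_; _⇔_; mk⇔; Equivalence)
open import Function.Definitions using (Injective; StrictlySurjective)
open import Function.Consequences.Propositional using (inverseʳ⇒injective; strictlyInverseʳ⇒inverseʳ)
open import Relation.Binary.PropositionalEquality
open import Relation.Nullary using (Dec)
open import Relation.Nullary.Decidable using (⌊_⌋; toWitness; fromWitness)
open import Algebra.Bundles using (CommutativeRing)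
open import Algebra.Properties.CommutativeSemigroup +-commutativeSemigroup using (x∙yz≈y∙xz)
open import Algebra.Properties.CommutativeSemigroup *-commutativeSemigroup
  using () renaming (x∙yz≈y∙xz to x∙yz≈y∙xz-*)
open import Algebra.Properties.CommutativeSemigroup
  (CommutativeRing.+-commutativeSemigroup xor-∧-commutativeRing) using (interchange)

open Equivalence using (to; from)

private variable
  A A′ : Set
  k n : ℕ

true≢false : true ≢ false
true≢false ()

≡-from-⇔ : {a b : Bool} → (a ≡ true → b ≡ true) → (b ≡ true → a ≡ true) → a ≡ b
≡-from-⇔ f g = ⇔→≡ (mk⇔ f g)

∧⇔ : {a b : Bool} → a ∧ b ≡ true ⇔ (a ≡ true × b ≡ true)
∧⇔ {true} {true} = mk⇔ (λ _ → refl , refl) (λ _ → refl)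
∧⇔ {true} {false} = mk⇔ (λ ()) (λ ())
∧⇔ {false} = mk⇔ (λ ()) (λ ())

not⇔ : {a : Bool} → not a ≡ true ⇔ a ≡ false
not⇔ {false} = mk⇔ (λ _ → refl) (λ _ → refl)
not⇔ {true}  = mk⇔ (λ ()) (λ ())

xor≡false⇔ : {a b : Bool} → a xor b ≡ false ⇔ a ≡ b
xor≡false⇔ {false} {false} = mk⇔ (λ _ → refl) (λ _ → refl)
xor≡false⇔ {false} {true}  = mk⇔ (λ ()) (λ ())
xor≡false⇔ {true}  {false} = mk⇔ (λ ()) (λ ())
xor≡false⇔ {true}  {true}  = mk⇔ (λ _ → refl) (λ _ → refl)

not∨not⇔ : {a b : Bool} → not a ∨ not b ≡ true ⇔ (a ≡ true → b ≡ false)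
not∨not⇔ {false} {_}     = mk⇔ (λ _ ()) (λ _ → refl)
not∨not⇔ {true}  {false} = mk⇔ (λ _ _ → refl) (λ _ → refl)
not∨not⇔ {true}  {true}  = mk⇔ (λ ()) (λ f → sym (f refl))

⌊⌋⇔ : {P : Set} (d : Dec P) → ⌊ d ⌋ ≡ true ⇔ P
⌊⌋⇔ d = mk⇔ (λ e → toWitness (from T-≡ e)) (λ p → to T-≡ (fromWitness p))

Complete : {A : Set} → List A → Set
Complete xs = ∀ a → a ∈ xs

Bool-complete : Complete Bool-elems
Bool-complete false = here refl
Bool-complete true  = there (here refl)

F4-complete : Complete F4-elems
F4-complete 𝟎  = here refl
F4-complete 𝟏  = there (here refl)
F4-complete ω  = there (there (here refl))
F4-complete ω² = there (there (there (here refl)))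

allVecs-complete : {A : Set} {xs : List A} → Complete xs → ∀ {n} → Complete (allVecs xs n)
allVecs-complete cov []      = here refl
allVecs-complete {xs = xs} cov {suc n} (a ∷ v) =
  ∈-concatMap⁺ (λ b → L.map (b ∷_) (allVecs xs n))
    (Any.map (λ { refl → ∈-map⁺ (a ∷_) (allVecs-complete cov v) }) (cov a))

module _ {A : Set} {xs : List A} (cov : Complete xs) {n : ℕ} (p : Vec A n → Bool) where

  all-allVecs : all p (allVecs xs n) ≡ true ⇔ (∀ v → p v ≡ true)
  all-allVecs = mk⇔
    (λ e v → to T-≡ (All.lookup (all⁺ p _ (from T-≡ e)) (allVecs-complete cov v)))
    (λ h → to T-≡ (all⁻ p {allVecs xs n} (All.tabulate (λ {v} _ → from T-≡ (h v)))))

  any-allVecs : any p (allVecs xs n) ≡ true ⇔ ∃ (λ v → p v ≡ true)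
  any-allVecs = mk⇔
    (λ e → let v , t = Any.satisfied (any⁻ p (allVecs xs n) (from (T-≡ {any p (allVecs xs n)}) e)) in v , to T-≡ t)
    (λ (v , e) → to T-≡ (any⁺ {xs = allVecs xs n} p (Any.map (λ { refl → from T-≡ e }) (allVecs-complete cov v))))

  witness-or-none : ∃ (λ v → p v ≡ true) ⊎ (∀ v → p v ≡ false)
  witness-or-none with any p (allVecs xs n) in eq
  ... | true  = inj₁ (to any-allVecs eq)
  ... | false = inj₂ (λ v → ¬-not (λ pv → true≢false (trans (sym (from any-allVecs (v , pv))) eq)))

orthogonal⇔ : {xs : List A} → Complete xs → (C ip : Vec A n → Bool) →
              all (λ x → not (C x) ∨ not (ip x)) (allVecs xs n) ≡ true ⇔ (∀ x → C x ≡ true → ip x ≡ false)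
orthogonal⇔ cov C ip = mk⇔
  (λ e x → to not∨not⇔ (to (all-allVecs cov _) e x))
  (λ h → from (all-allVecs cov _) (λ x → from not∨not⇔ (h x)))

count-cong : {p q : A → Bool} → (∀ x → p x ≡ q x) → ∀ ys → countᵇ p ys ≡ countᵇ q ys
count-cong p≗q []       = refl
count-cong {q = q} p≗q (y ∷ ys) rewrite p≗q y with q y
... | true  = cong suc (count-cong p≗q ys)
... | false = count-cong p≗q ys

count-false : (ys : List A) → countᵇ (λ _ → false) ys ≡ 0
count-false []       = refl
count-false (_ ∷ ys) = count-false ys

count-++ : (p : A → Bool) (ys zs : List A) → countᵇ p (ys L.++ zs) ≡ countᵇ p ys + countᵇ p zs
count-++ p []       zs = refl
count-++ p (y ∷ ys) zs with p y
... | true  = cong suc (count-++ p ys zs)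
... | false = count-++ p ys zs

count-map : (p : A′ → Bool) (f : A → A′) (ys : List A) →
            countᵇ p (L.map f ys) ≡ countᵇ (p ∘ f) ys
count-map p f []       = refl
count-map p f (y ∷ ys) with p (f y)
... | true  = cong suc (count-map p f ys)
... | false = count-map p f ys

count-concatMap : (p : A′ → Bool) (f : A → List A′) (ys : List A) →
                  countᵇ p (concatMap f ys) ≡ sum (L.map (countᵇ p ∘ f) ys)
count-concatMap p f []       = refl
count-concatMap p f (y ∷ ys) =
  trans (count-++ p (f y) (concatMap f ys)) (cong (countᵇ p (f y) +_) (count-concatMap p f ys))

count-split : (p q : A → Bool) (ys : List A) →
              countᵇ (λ y → p y ∧ not (q y)) ys + countᵇ (λ y → p y ∧ q y) ys ≡ countᵇ p ys
count-split p q []       = refl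
count-split p q (y ∷ ys) with p y | q y
... | true  | true  = trans (x∙yz≈y∙xz (countᵇ (λ y → p y ∧ not (q y)) ys) 1 _)
                            (cong suc (count-split p q ys))
... | true  | false = cong suc (count-split p q ys)
... | false | _     = count-split p q ys

count≢0⇒witness : (p : A → Bool) (ys : List A) → countᵇ p ys ≢ 0 → ∃ λ y → p y ≡ true
count≢0⇒witness p []       c≢0 = ⊥-elim (c≢0 refl)
count≢0⇒witness p (y ∷ ys) c≢0 with p y in eq
... | true  = y , eq
... | false = count≢0⇒witness p ys c≢0

witness⇒count≢0 : (p : A → Bool) {ys : List A} {y : A} → y ∈ ys → p y ≡ true → countᵇ p ys ≢ 0
witness⇒count≢0 p (here refl) py rewrite py = λ ()
witness⇒count≢0 p {y′ ∷ _} (there y∈ys) py with p y′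
... | true  = λ ()
... | false = witness⇒count≢0 p y∈ys py

sum-map-concatMap : (F : A′ → ℕ) (g : A → List A′) (ys : List A) →
                    sum (L.map F (concatMap g ys)) ≡ sum (L.map (λ a → sum (L.map F (g a))) ys)
sum-map-concatMap F g []       = refl
sum-map-concatMap F g (y ∷ ys) = begin
  sum (L.map F (g y L.++ concatMap g ys))                  ≡⟨ cong sum (map-++ F (g y) _) ⟩
  sum (L.map F (g y) L.++ L.map F (concatMap g ys))         ≡⟨ sum-++ (L.map F (g y)) _ ⟩
  sum (L.map F (g y)) + sum (L.map F (concatMap g ys))     ≡⟨ cong (_ +_) (sum-map-concatMap F g ys) ⟩
  sum (L.map F (g y)) + sum (L.map (λ a → sum (L.map F (g a))) ys) ∎
  where open ≡-Reasoning

module _ {xs : List A} where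

  count-suc : ∀ {n} (p : Vec A (suc n) → Bool) →
              countᵇ p (allVecs xs (suc n)) ≡ sum (L.map (λ a → countᵇ (λ v → p (a ∷ v)) (allVecs xs n)) xs)
  count-suc {n} p = trans (count-concatMap p (λ a → L.map (a ∷_) (allVecs xs n)) xs)
                          (cong sum (map-cong (λ a → count-map p (a ∷_) (allVecs xs n)) xs))

  count-prefix : ∀ k {N} (p : Vec A (k + N) → Bool) →
                 countᵇ p (allVecs xs (k + N))
                   ≡ sum (L.map (λ t → countᵇ (λ w → p (t ++ w)) (allVecs xs N)) (allVecs xs k))
  count-prefix zero    p = sym (+-identityʳ _)
  count-prefix (suc k) {N} p = begin
    countᵇ p (allVecs xs (suc k + N))
      ≡⟨ count-suc p ⟩
    sum (L.map (λ a → countᵇ (λ v → p (a ∷ v)) (allVecs xs (k + N))) xs)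
      ≡⟨ cong sum (map-cong (λ a → count-prefix k (λ v → p (a ∷ v))) xs) ⟩
    sum (L.map (λ a → sum (L.map (F ∘ (a ∷_)) (allVecs xs k))) xs)
      ≡⟨ cong sum (map-cong (λ a → cong sum (map-∘ (allVecs xs k))) xs) ⟩
    sum (L.map (λ a → sum (L.map F (L.map (a ∷_) (allVecs xs k)))) xs)
      ≡⟨ sum-map-concatMap F (λ a → L.map (a ∷_) (allVecs xs k)) xs ⟨
    sum (L.map F (allVecs xs (suc k))) ∎
    where
    open ≡-Reasoning
    F : Vec A (suc k) → ℕ
    F t = countᵇ (λ w → p (t ++ w)) (allVecs xs N)

dot-comm : (x y : Vec Bool n) → dot₂ x y ≡ dot₂ y x
dot-comm []      []      = refl
dot-comm (a ∷ x) (b ∷ y) = cong₂ _xor_ (∧-comm a b) (dot-comm x y)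

dot-zeroʳ : (x : Vec Bool n) → dot₂ x (replicate n false) ≡ false
dot-zeroʳ []      = refl
dot-zeroʳ (a ∷ x) rewrite ∧-zeroʳ a = dot-zeroʳ x

dot-zeroˡ : (x : Vec Bool n) → dot₂ (replicate n false) x ≡ false
dot-zeroˡ x = trans (dot-comm _ x) (dot-zeroʳ x)

dot-⊕ʳ : (x y z : Vec Bool n) → dot₂ x (y ⊕₂ z) ≡ dot₂ x y xor dot₂ x z
dot-⊕ʳ []      []      []      = refl
dot-⊕ʳ (a ∷ x) (b ∷ y) (c ∷ z) rewrite ∧-distribˡ-xor a b c | dot-⊕ʳ x y z =
  interchange (a ∧ b) (a ∧ c) (dot₂ x y) (dot₂ x z)

dot-⊕ˡ : (x y z : Vec Bool n) → dot₂ (x ⊕₂ y) z ≡ dot₂ x z xor dot₂ y z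
dot-⊕ˡ x y z = begin
  dot₂ (x ⊕₂ y) z           ≡⟨ dot-comm (x ⊕₂ y) z ⟩
  dot₂ z (x ⊕₂ y)           ≡⟨ dot-⊕ʳ z x y ⟩
  dot₂ z x xor dot₂ z y     ≡⟨ cong₂ _xor_ (dot-comm z x) (dot-comm z y) ⟩
  dot₂ x z xor dot₂ y z     ∎
  where open ≡-Reasoning

dot-++ : ∀ {k} (u v : Vec Bool k) (r s : Vec Bool n) → dot₂ (u ++ r) (v ++ s) ≡ dot₂ u v xor dot₂ r s
dot-++ []      []      r s = refl
dot-++ (a ∷ u) (b ∷ v) r s rewrite dot-++ u v r s = sym (xor-assoc (a ∧ b) (dot₂ u v) (dot₂ r s))

⊕₂-cancelʳ : (v u : Vec Bool n) → (v ⊕₂ u) ⊕₂ u ≡ v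
⊕₂-cancelʳ []      []      = refl
⊕₂-cancelʳ (a ∷ v) (b ∷ u) =
  cong₂ _∷_ (trans (xor-assoc a b b) (trans (cong (a xor_) (xor-same b)) (xor-identityʳ a))) (⊕₂-cancelʳ v u)

dual₂⇔ : (C : Code₂ n) (y : Vec Bool n) → dual₂ C y ≡ true ⇔ (∀ x → C x ≡ true → dot₂ x y ≡ false)
dual₂⇔ C y = orthogonal⇔ Bool-complete C (λ x → dot₂ x y)

dual₂-linear : (C : Code₂ n) → IsLinear₂ (dual₂ C)
dual₂-linear C =
  from (dual₂⇔ C _) (λ x _ → dot-zeroʳ x) ,
  λ y z Cy Cz → from (dual₂⇔ C _) λ x Cx →
    trans (dot-⊕ʳ x y z) (cong₂ _xor_ (to (dual₂⇔ C y) Cy x Cx) (to (dual₂⇔ C z) Cz x Cx))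

⊆-dual₂-dual₂ : (C : Code₂ n) (x : Vec Bool n) → C x ≡ true → dual₂ (dual₂ C) x ≡ true
⊆-dual₂-dual₂ C x Cx = from (dual₂⇔ (dual₂ C) x) (λ y C⊥y → trans (dot-comm y x) (to (dual₂⇔ C y) C⊥y x Cx))

count-⊕-invariant : (p : Vec Bool n → Bool) (u : Vec Bool n) →
  countᵇ (λ v → p (v ⊕₂ u)) (allVecs Bool-elems n) ≡ countᵇ p (allVecs Bool-elems n)
count-⊕-invariant {zero}  p []      = refl
count-⊕-invariant {suc n} p (b ∷ u) = begin
  countᵇ (λ v → p (v ⊕₂ (b ∷ u))) (allVecs Bool-elems (suc n))   ≡⟨ count-suc (λ v → p (v ⊕₂ (b ∷ u))) ⟩
  K (false xor b) + (K (true xor b) + 0)                          ≡⟨ swap b ⟩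
  K false + (K true + 0)                                          ≡⟨ cong₂ (λ x y → x + (y + 0)) (K≡ false) (K≡ true) ⟩
  sum (L.map (λ c → countᵇ (λ v → p (c ∷ v)) (allVecs Bool-elems n)) Bool-elems) ≡⟨ count-suc p ⟨
  countᵇ p (allVecs Bool-elems (suc n))                           ∎
  where
  open ≡-Reasoning
  K : Bool → ℕ
  K c = countᵇ (λ v → p (c ∷ (v ⊕₂ u))) (allVecs Bool-elems n)
  K≡ : ∀ c → K c ≡ countᵇ (λ v → p (c ∷ v)) (allVecs Bool-elems n)
  K≡ c = count-⊕-invariant (λ v → p (c ∷ v)) u
  swap : ∀ b → K (false xor b) + (K (true xor b) + 0) ≡ K false + (K true + 0)
  swap false = refl
  swap true  = x∙yz≈y∙xz (K true) (K false) 0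

-- C₀ is C shortened at the first coordinate. If some codeword starts with 1, C is two cosets
-- of 0C₀ and y ↦ (u · y , y) maps C₀^⊥ onto C^⊥; otherwise C = 0C₀ and C^⊥ = F₂ × C₀^⊥.
module FirstCoordinate {N : ℕ} (C : Code₂ (suc N)) (lin : IsLinear₂ C) where

  C₀ : Code₂ N
  C₀ v = C (false ∷ v)

  C₀-linear : IsLinear₂ C₀
  C₀-linear = proj₁ lin , λ x y → proj₂ lin (false ∷ x) (false ∷ y)

  private
    AV = allVecs Bool-elems N

  module SomeLeadingOne (u : Vec Bool N) (Cu : C (true ∷ u) ≡ true) where

    C-leading-one : ∀ v → C (true ∷ v) ≡ C₀ (v ⊕₂ u)
    C-leading-one v = ≡-from-⇔
      (λ Cv → proj₂ lin (true ∷ v) (true ∷ u) Cv Cu)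
      (λ C₀v → subst (λ w → C (true ∷ w) ≡ true) (⊕₂-cancelʳ v u)
                     (proj₂ lin (false ∷ (v ⊕₂ u)) (true ∷ u) C₀v Cu))

    dual-cons : ∀ b y → dual₂ C (b ∷ y) ≡ dual₂ C₀ y ∧ not (b xor dot₂ u y)
    dual-cons b y = ≡-from-⇔
      (λ C⊥by → let h = to (dual₂⇔ C (b ∷ y)) C⊥by in
        from ∧⇔ (from (dual₂⇔ C₀ y) (λ x → h (false ∷ x)) , from not⇔ (h (true ∷ u) Cu)))
      (λ e → let C₀⊥y , b≡u·y = to ∧⇔ e
                 h = to (dual₂⇔ C₀ y) C₀⊥y in
        from (dual₂⇔ C (b ∷ y)) λ
          { (false ∷ x) Cx → h x Cx
          ; (true ∷ x) Cx → trans (cong (b xor_) (x·y≡u·y h x Cx)) (to not⇔ b≡u·y) })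
      where
      x·y≡u·y : (∀ x → C₀ x ≡ true → dot₂ x y ≡ false) → ∀ x → C (true ∷ x) ≡ true → dot₂ x y ≡ dot₂ u y
      x·y≡u·y h x Cx = to xor≡false⇔ (trans (sym (dot-⊕ˡ x u y)) (h (x ⊕₂ u) (trans (sym (C-leading-one x)) Cx)))

    card-step : card₂ C₀ * card₂ (dual₂ C₀) ≡ 2 ^ N → card₂ C * card₂ (dual₂ C) ≡ 2 ^ suc N
    card-step IH = begin
      card₂ C * card₂ (dual₂ C)               ≡⟨ cong₂ _*_ card-C card-D ⟩
      2 * card₂ C₀ * card₂ (dual₂ C₀)         ≡⟨ *-assoc 2 (card₂ C₀) _ ⟩
      2 * (card₂ C₀ * card₂ (dual₂ C₀))       ≡⟨ cong (2 *_) IH ⟩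
      2 ^ suc N                               ∎
      where
      open ≡-Reasoning
      card-C : card₂ C ≡ 2 * card₂ C₀
      card-C = trans (count-suc C)
        (cong (λ k → card₂ C₀ + (k + 0)) (trans (count-cong C-leading-one AV) (count-⊕-invariant C₀ u)))
      card-D : card₂ (dual₂ C) ≡ card₂ (dual₂ C₀)
      card-D = begin
        card₂ (dual₂ C)
          ≡⟨ count-suc (dual₂ C) ⟩
        countᵇ (λ y → dual₂ C (false ∷ y)) AV + (countᵇ (λ y → dual₂ C (true ∷ y)) AV + 0)
          ≡⟨ cong₂ _+_ (count-cong (dual-cons false) AV)
                       (trans (+-identityʳ _) (count-cong (λ y → trans (dual-cons true y)
                                 (cong (dual₂ C₀ y ∧_) (not-involutive (dot₂ u y)))) AV)) ⟩
        countᵇ (λ y → dual₂ C₀ y ∧ not (dot₂ u y)) AV + countᵇ (λ y → dual₂ C₀ y ∧ dot₂ u y) AV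
          ≡⟨ count-split (dual₂ C₀) (dot₂ u) AV ⟩
        card₂ (dual₂ C₀) ∎

    dual-lift : ∀ y → dual₂ C₀ y ≡ true → dual₂ C (dot₂ u y ∷ y) ≡ true
    dual-lift y C₀⊥y = trans (dual-cons _ y) (cong₂ _∧_ C₀⊥y (cong not (xor-same (dot₂ u y))))

    dual-dual-step : (∀ z → dual₂ (dual₂ C₀) z ≡ true → C₀ z ≡ true) →
                     ∀ z → dual₂ (dual₂ C) z ≡ true → C z ≡ true
    dual-dual-step IH (false ∷ z) h = IH z (from (dual₂⇔ (dual₂ C₀) z) λ y C₀⊥y →
      trans (cong (_xor dot₂ y z) (sym (∧-zeroʳ (dot₂ u y))))
            (to (dual₂⇔ (dual₂ C) _) h _ (dual-lift y C₀⊥y)))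
    dual-dual-step IH (true ∷ z) h = trans (C-leading-one z) (IH (z ⊕₂ u) (from (dual₂⇔ (dual₂ C₀) _) λ y C₀⊥y →
      let u·y≡y·z = to xor≡false⇔ (trans (cong (_xor dot₂ y z) (sym (∧-identityʳ (dot₂ u y))))
                                         (to (dual₂⇔ (dual₂ C) _) h _ (dual-lift y C₀⊥y)))
      in trans (dot-⊕ʳ y z u) (from xor≡false⇔ (trans (sym u·y≡y·z) (dot-comm u y)))))

  module NoLeadingOne (none : ∀ v → C (true ∷ v) ≡ false) where

    dual-cons : ∀ b y → dual₂ C (b ∷ y) ≡ dual₂ C₀ y
    dual-cons b y = ≡-from-⇔
      (λ C⊥by → from (dual₂⇔ C₀ y) (λ x → to (dual₂⇔ C (b ∷ y)) C⊥by (false ∷ x)))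
      (λ C₀⊥y → from (dual₂⇔ C (b ∷ y)) λ
        { (false ∷ x) Cx → to (dual₂⇔ C₀ y) C₀⊥y x Cx
        ; (true ∷ x) Cx → ⊥-elim (true≢false (trans (sym Cx) (none x))) })

    card-step : card₂ C₀ * card₂ (dual₂ C₀) ≡ 2 ^ N → card₂ C * card₂ (dual₂ C) ≡ 2 ^ suc N
    card-step IH = begin
      card₂ C * card₂ (dual₂ C)               ≡⟨ cong₂ _*_ card-C card-D ⟩
      card₂ C₀ * (2 * card₂ (dual₂ C₀))       ≡⟨ x∙yz≈y∙xz-* (card₂ C₀) 2 _ ⟩
      2 * (card₂ C₀ * card₂ (dual₂ C₀))       ≡⟨ cong (2 *_) IH ⟩
      2 ^ suc N                               ∎
      where
      open ≡-Reasoning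
      card-C : card₂ C ≡ card₂ C₀
      card-C = trans (count-suc C)
        (trans (cong (λ k → card₂ C₀ + (k + 0)) (trans (count-cong none AV) (count-false AV))) (+-identityʳ _))
      card-D : card₂ (dual₂ C) ≡ 2 * card₂ (dual₂ C₀)
      card-D = trans (count-suc (dual₂ C))
        (cong₂ (λ k l → k + (l + 0)) (count-cong (dual-cons false) AV) (count-cong (dual-cons true) AV))

    dual-dual-step : (∀ z → dual₂ (dual₂ C₀) z ≡ true → C₀ z ≡ true) →
                     ∀ z → dual₂ (dual₂ C) z ≡ true → C z ≡ true
    dual-dual-step IH (false ∷ z) h = IH z (from (dual₂⇔ (dual₂ C₀) z) λ y C₀⊥y →
      to (dual₂⇔ (dual₂ C) _) h (false ∷ y) (trans (dual-cons false y) C₀⊥y))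
    dual-dual-step IH (true ∷ z) h = ⊥-elim (true≢false (begin
      true                                       ≡⟨ cong (true xor_) (dot-zeroˡ z) ⟨
      dot₂ (true ∷ replicate N false) (true ∷ z)  ≡⟨ to (dual₂⇔ (dual₂ C) _) h _ e₁∈C⊥ ⟩
      false                                      ∎))
      where
      open ≡-Reasoning
      e₁∈C⊥ : dual₂ C (true ∷ replicate N false) ≡ true
      e₁∈C⊥ = trans (dual-cons true _) (proj₁ (dual₂-linear C₀))

card-dual₂ : (C : Code₂ n) → IsLinear₂ C → card₂ C * card₂ (dual₂ C) ≡ 2 ^ n
card-dual₂ {zero}  C (C0 , _) rewrite C0 = refl
card-dual₂ {suc n} C lin with witness-or-none Bool-complete (λ v → C (true ∷ v))
... | inj₁ (u , Cu) = SomeLeadingOne.card-step u Cu (card-dual₂ C₀ C₀-linear)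
  where open FirstCoordinate C lin
... | inj₂ none     = NoLeadingOne.card-step none (card-dual₂ C₀ C₀-linear)
  where open FirstCoordinate C lin

dual₂-dual₂-⊆ : (C : Code₂ n) → IsLinear₂ C → ∀ z → dual₂ (dual₂ C) z ≡ true → C z ≡ true
dual₂-dual₂-⊆ {zero}  C (C0 , _) [] _ = C0
dual₂-dual₂-⊆ {suc n} C lin with witness-or-none Bool-complete (λ v → C (true ∷ v))
... | inj₁ (u , Cu) = SomeLeadingOne.dual-dual-step u Cu (dual₂-dual₂-⊆ C₀ C₀-linear)
  where open FirstCoordinate C lin
... | inj₂ none     = NoLeadingOne.dual-dual-step none (dual₂-dual₂-⊆ C₀ C₀-linear)
  where open FirstCoordinate C lin

dual₂-dual₂ : (C : Code₂ n) → IsLinear₂ C → ∀ z → dual₂ (dual₂ C) z ≡ C z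
dual₂-dual₂ C lin z = ≡-from-⇔ (dual₂-dual₂-⊆ C lin z) (⊆-dual₂-dual₂ C z)

encode : (F4 → Vec Bool k) → Vec F4 n → Vec Bool (n * k)
encode e x = V.concat (V.map e x)

image : (F4 → Vec Bool k) → Code₄ n → Code₂ (n * k)
image {n = n} e C z = any (λ y → C y ∧ ⌊ ≡-dec BoolP._≟_ (encode e y) z ⌋) (allVecs F4-elems n)

module _ (e : F4 → Vec Bool k) where

  image⇔ : (C : Code₄ n) (z : Vec Bool (n * k)) →
           image e C z ≡ true ⇔ ∃ λ y → C y ≡ true × encode e y ≡ z
  image⇔ C z = mk⇔
    (λ im → let y , h = to (any-allVecs F4-complete _) im
                Cy , eq = to ∧⇔ h in y , Cy , to (⌊⌋⇔ (≡-dec BoolP._≟_ _ z)) eq)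
    (λ (y , Cy , eq) → from (any-allVecs F4-complete _) (y , from ∧⇔ (Cy , from (⌊⌋⇔ (≡-dec BoolP._≟_ _ z)) eq)))

  encode-⊕ : (∀ a b → e (a +₄ b) ≡ e a ⊕₂ e b) → (x y : Vec F4 n) → encode e (x ⊕₄ y) ≡ encode e x ⊕₂ encode e y
  encode-⊕ hom []      []      = refl
  encode-⊕ hom (a ∷ x) (b ∷ y) =
    trans (cong₂ _++_ (hom a b) (encode-⊕ hom x y)) (sym (zipWith-++ _xor_ (e a) _ (e b) _))

  encode-zero : e 𝟎 ≡ replicate k false → ∀ n → encode e (replicate n 𝟎) ≡ replicate (n * k) false
  encode-zero e𝟎 zero    = refl
  encode-zero e𝟎 (suc n) = trans (cong₂ _++_ e𝟎 (encode-zero e𝟎 n)) (replicate-++ k)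
    where
    replicate-++ : ∀ k {m} → replicate k false ++ replicate m false ≡ replicate (k + m) false
    replicate-++ zero    = refl
    replicate-++ (suc k) = cong (false ∷_) (replicate-++ k)

  image-linear : (∀ a b → e (a +₄ b) ≡ e a ⊕₂ e b) → e 𝟎 ≡ replicate k false →
                 (C : Code₄ n) → IsAdditive C → IsLinear₂ (image e C)
  image-linear {n = n} hom e𝟎 C (C0 , C+) =
    from (image⇔ C _) (replicate n 𝟎 , C0 , encode-zero e𝟎 n) ,
    λ z z′ im im′ → let y , Cy , ey = to (image⇔ C z) im
                        y′ , Cy′ , ey′ = to (image⇔ C z′) im′ in
      from (image⇔ C _) (y ⊕₄ y′ , C+ y y′ Cy Cy′ , trans (encode-⊕ hom y y′) (cong₂ _⊕₂_ ey ey′))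

  encode-injective : Injective _≡_ _≡_ e → Injective _≡_ _≡_ (encode {n = n} e)
  encode-injective inj {[]}    {[]}    _  = refl
  encode-injective inj {a ∷ x} {b ∷ y} eq =
    cong₂ _∷_ (inj (++-injectiveˡ (e a) (e b) eq)) (encode-injective inj (++-injectiveʳ (e a) (e b) eq))

  encode-surjective : StrictlySurjective _≡_ e → StrictlySurjective _≡_ (encode {n = n} e)
  encode-surjective {n = zero} surj []  = [] , refl
  encode-surjective {n = suc n} surj z =
    let a , ea = surj (take k z)
        x , ex = encode-surjective surj (drop k z)
    in a ∷ x , trans (cong₂ _++_ ea ex) (take++drop≡id k z)

  image-cons : Injective _≡_ _≡_ e → (C : Code₄ (suc n)) (a : F4) (w : Vec Bool (n * k)) →
               image e C (e a ++ w) ≡ image e (λ y → C (a ∷ y)) w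
  image-cons inj C a w = ≡-from-⇔
    (λ im → let y , Cy , ey = to (image⇔ C _) im in tail-preimage y Cy ey)
    (λ im → let y , Cy , ey = to (image⇔ _ w) im in from (image⇔ C _) (a ∷ y , Cy , cong (e a ++_) ey))
    where
    tail-preimage : ∀ y → C y ≡ true → encode e y ≡ e a ++ w → image e (λ y → C (a ∷ y)) w ≡ true
    tail-preimage (b ∷ y) Cy ey with inj (++-injectiveˡ (e b) (e a) ey)
    ... | refl = from (image⇔ _ w) (y , Cy , ++-injectiveʳ (e b) (e a) ey)

  image-outside : (C : Code₄ (suc n)) {t : Vec Bool k} → (∀ a → e a ≢ t) → (w : Vec Bool (n * k)) →
                  image e C (t ++ w) ≡ false
  image-outside C {t} t∉e w with image e C (t ++ w) in im
  ... | false = refl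
  ... | true with to (image⇔ C _) im
  ...   | b ∷ y , _ , ey = ⊥-elim (t∉e b (++-injectiveˡ (e b) _ ey))

  image-nil : (C : Code₄ 0) → image e C [] ≡ C []
  image-nil C = ≡-from-⇔ (λ im → let y , Cy , ey = to (image⇔ C []) im in subst (λ y → C y ≡ true) (nil y) Cy)
                         (λ C[] → from (image⇔ C []) ([] , C[] , refl))
    where
    nil : (y : Vec F4 0) → y ≡ []
    nil [] = refl

BlockSum : (F4 → Vec Bool k) → Set
BlockSum {k} e = (G : Vec Bool k → ℕ) → (∀ t → (∀ a → e a ≢ t) → G t ≡ 0) →
                 sum (L.map G (allVecs Bool-elems k)) ≡ sum (L.map (G ∘ e) F4-elems)

count-image : (e : F4 → Vec Bool k) → Injective _≡_ _≡_ e → BlockSum e →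
              ∀ n (C : Code₄ n) (h : Vec Bool (n * k) → Bool) →
              countᵇ (λ z → image e C z ∧ h z) (allVecs Bool-elems (n * k))
                ≡ countᵇ (λ y → C y ∧ h (encode e y)) (allVecs F4-elems n)
count-image e inj blocks zero C h =
  count-cong {p = λ z → image e C z ∧ h z} {q = λ z → C [] ∧ h z}
             (λ { [] → cong (_∧ h []) (image-nil e C) }) (allVecs Bool-elems 0)
count-image {k} e inj blocks (suc n) C h = begin
  countᵇ P (allVecs Bool-elems (k + n * k))
    ≡⟨ count-prefix k P ⟩
  sum (L.map (λ t → countᵇ (λ w → P (t ++ w)) AV) (allVecs Bool-elems k))
    ≡⟨ blocks _ (λ t t∉e → trans (count-cong (λ w → cong (_∧ h (t ++ w)) (image-outside e C t∉e w)) AV)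
                                 (count-false AV)) ⟩
  sum (L.map (λ a → countᵇ (λ w → P (e a ++ w)) AV) F4-elems)
    ≡⟨ cong sum (map-cong (λ a → trans (count-cong (λ w → cong (_∧ h (e a ++ w)) (image-cons e inj C a w)) AV)
                                       (count-image e inj blocks n (λ y → C (a ∷ y)) (λ w → h (e a ++ w))))
                          F4-elems) ⟩
  sum (L.map (λ a → countᵇ (λ y → C (a ∷ y) ∧ h (encode e (a ∷ y))) (allVecs F4-elems n)) F4-elems)
    ≡⟨ count-suc (λ y → C y ∧ h (encode e y)) ⟨
  countᵇ (λ y → C y ∧ h (encode e y)) (allVecs F4-elems (suc n)) ∎
  where
  open ≡-Reasoning
  P : Vec Bool (suc n * k) → Bool
  P z = image e C z ∧ h z
  AV = allVecs Bool-elems (n * k)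

card-image : (e : F4 → Vec Bool k) → Injective _≡_ _≡_ e → BlockSum e → (C : Code₄ n) →
             card₂ (image e C) ≡ card₄ C
card-image {n = n} e inj blocks C = begin
  card₂ (image e C)                                              ≡⟨ count-cong (λ z → sym (∧-identityʳ (image e C z))) (allVecs Bool-elems (n * _)) ⟩
  countᵇ (λ z → image e C z ∧ true) (allVecs Bool-elems (n * _)) ≡⟨ count-image e inj blocks n C (λ _ → true) ⟩
  countᵇ (λ y → C y ∧ true) (allVecs F4-elems n)                 ≡⟨ count-cong (λ y → ∧-identityʳ (C y)) (allVecs F4-elems n) ⟩
  card₄ C                                                        ∎
  where open ≡-Reasoning

tp : F4 → F4 → Bool
tp a b = Tr (a *₄ (b *₄ b))

tp-comm : ∀ a b → tp a b ≡ tp b a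
tp-comm 𝟎  = λ { 𝟎 → refl ; 𝟏 → refl ; ω → refl ; ω² → refl }
tp-comm 𝟏  = λ { 𝟎 → refl ; 𝟏 → refl ; ω → refl ; ω² → refl }
tp-comm ω  = λ { 𝟎 → refl ; 𝟏 → refl ; ω → refl ; ω² → refl }
tp-comm ω² = λ { 𝟎 → refl ; 𝟏 → refl ; ω → refl ; ω² → refl }

traceIP-comm : (x y : Vec F4 n) → traceIP x y ≡ traceIP y x
traceIP-comm []      []      = refl
traceIP-comm (a ∷ x) (b ∷ y) = cong₂ _xor_ (tp-comm a b) (traceIP-comm x y)

fromPair : Bool → Bool → F4
fromPair false false = 𝟎
fromPair true  false = 𝟏
fromPair false true  = ω
fromPair true  true  = ω²

-- The trace form is alternating (Tr (x³) = 0), so it is not the dot product in any single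
-- coordinate system; against the swapped coordinates bits′ it is (tp≡dot-bits).
bits bits′ : F4 → Vec Bool 2
bits  𝟎  = false ∷ false ∷ []
bits  𝟏  = true  ∷ false ∷ []
bits  ω  = false ∷ true  ∷ []
bits  ω² = true  ∷ true  ∷ []
bits′ 𝟎  = false ∷ false ∷ []
bits′ 𝟏  = false ∷ true  ∷ []
bits′ ω  = true  ∷ false ∷ []
bits′ ω² = true  ∷ true  ∷ []

bits⁻¹ bits′⁻¹ : Vec Bool 2 → F4
bits⁻¹  (a ∷ b ∷ []) = fromPair a b
bits′⁻¹ (b ∷ a ∷ []) = fromPair a b

bits-injective : Injective _≡_ _≡_ bits
bits-injective = inverseʳ⇒injective {f⁻¹ = bits⁻¹} bits
  (strictlyInverseʳ⇒inverseʳ {f⁻¹ = bits⁻¹} bits λ { 𝟎 → refl ; 𝟏 → refl ; ω → refl ; ω² → refl })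

bits′-injective : Injective _≡_ _≡_ bits′
bits′-injective = inverseʳ⇒injective {f⁻¹ = bits′⁻¹} bits′
  (strictlyInverseʳ⇒inverseʳ {f⁻¹ = bits′⁻¹} bits′ λ { 𝟎 → refl ; 𝟏 → refl ; ω → refl ; ω² → refl })

bits′-surjective : StrictlySurjective _≡_ bits′
bits′-surjective t = bits′⁻¹ t , section t
  where
  section : ∀ t → bits′ (bits′⁻¹ t) ≡ t
  section (false ∷ false ∷ []) = refl
  section (false ∷ true  ∷ []) = refl
  section (true  ∷ false ∷ []) = refl
  section (true  ∷ true  ∷ []) = refl

bits-blocks : BlockSum bits
bits-blocks G _ = cong (G (false ∷ false ∷ []) +_) (x∙yz≈y∙xz (G (false ∷ true ∷ [])) (G (true ∷ false ∷ [])) _)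

bits′-blocks : BlockSum bits′
bits′-blocks G _ = refl

bits-⊕ : ∀ a b → bits (a +₄ b) ≡ bits a ⊕₂ bits b
bits-⊕ 𝟎  = λ { 𝟎 → refl ; 𝟏 → refl ; ω → refl ; ω² → refl }
bits-⊕ 𝟏  = λ { 𝟎 → refl ; 𝟏 → refl ; ω → refl ; ω² → refl }
bits-⊕ ω  = λ { 𝟎 → refl ; 𝟏 → refl ; ω → refl ; ω² → refl }
bits-⊕ ω² = λ { 𝟎 → refl ; 𝟏 → refl ; ω → refl ; ω² → refl }

tp≡dot-bits : ∀ a b → tp a b ≡ dot₂ (bits a) (bits′ b)
tp≡dot-bits 𝟎  = λ { 𝟎 → refl ; 𝟏 → refl ; ω → refl ; ω² → refl }
tp≡dot-bits 𝟏  = λ { 𝟎 → refl ; 𝟏 → refl ; ω → refl ; ω² → refl }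
tp≡dot-bits ω  = λ { 𝟎 → refl ; 𝟏 → refl ; ω → refl ; ω² → refl }
tp≡dot-bits ω² = λ { 𝟎 → refl ; 𝟏 → refl ; ω → refl ; ω² → refl }

traceIP≡dot-bits : (x y : Vec F4 n) → traceIP x y ≡ dot₂ (encode bits x) (encode bits′ y)
traceIP≡dot-bits []      []      = refl
traceIP≡dot-bits (a ∷ x) (b ∷ y) =
  trans (cong₂ _xor_ (tp≡dot-bits a b) (traceIP≡dot-bits x y)) (sym (dot-++ (bits a) (bits′ b) _ _))

traceIP-⊕ˡ : (x y z : Vec F4 n) → traceIP (x ⊕₄ y) z ≡ traceIP x z xor traceIP y z
traceIP-⊕ˡ x y z = begin
  traceIP (x ⊕₄ y) z                                               ≡⟨ traceIP≡dot-bits (x ⊕₄ y) z ⟩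
  dot₂ (encode bits (x ⊕₄ y)) (encode bits′ z)                     ≡⟨ cong (λ u → dot₂ u _) (encode-⊕ bits bits-⊕ x y) ⟩
  dot₂ (encode bits x ⊕₂ encode bits y) (encode bits′ z)           ≡⟨ dot-⊕ˡ (encode bits x) _ _ ⟩
  dot₂ (encode bits x) (encode bits′ z) xor dot₂ (encode bits y) (encode bits′ z)
                                                                   ≡⟨ cong₂ _xor_ (traceIP≡dot-bits x z) (traceIP≡dot-bits y z) ⟨
  traceIP x z xor traceIP y z                                      ∎
  where open ≡-Reasoning

traceIP-⊕ʳ : (x y z : Vec F4 n) → traceIP x (y ⊕₄ z) ≡ traceIP x y xor traceIP x z
traceIP-⊕ʳ x y z = trans (traceIP-comm x _)
  (trans (traceIP-⊕ˡ y z x) (cong₂ _xor_ (traceIP-comm y x) (traceIP-comm z x)))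

traceIP-zeroʳ : (x : Vec F4 n) → traceIP x (replicate n 𝟎) ≡ false
traceIP-zeroʳ {n} x = trans (traceIP≡dot-bits x _)
  (trans (cong (dot₂ (encode bits x)) (encode-zero bits′ refl n)) (dot-zeroʳ (encode bits x)))

dual₄⇔ : (C : Code₄ n) (y : Vec F4 n) → dual₄ C y ≡ true ⇔ (∀ x → C x ≡ true → traceIP x y ≡ false)
dual₄⇔ C y = orthogonal⇔ F4-complete C (λ x → traceIP x y)

dual₄-additive : (C : Code₄ n) → IsAdditive (dual₄ C)
dual₄-additive C =
  from (dual₄⇔ C _) (λ x _ → traceIP-zeroʳ x) ,
  λ y z Cy Cz → from (dual₄⇔ C _) λ x Cx →
    trans (traceIP-⊕ʳ x y z) (cong₂ _xor_ (to (dual₄⇔ C y) Cy x Cx) (to (dual₄⇔ C z) Cz x Cx))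

module QuaternaryDuality {n : ℕ} (Q : Code₄ n) where

  private
    D  = dual₄ Q
    Qᵇ = image bits Q

  dual-Qᵇ : ∀ z → dual₂ Qᵇ z ≡ image bits′ D z
  dual-Qᵇ z = ≡-from-⇔
    (λ Qᵇ⊥z → let c , ec = encode-surjective bits′ bits′-surjective z in
      from (image⇔ bits′ D z) (c , from (dual₄⇔ Q c) (λ x Qx → begin
        traceIP x c                          ≡⟨ traceIP≡dot-bits x c ⟩
        dot₂ (encode bits x) (encode bits′ c) ≡⟨ cong (dot₂ (encode bits x)) ec ⟩
        dot₂ (encode bits x) z               ≡⟨ to (dual₂⇔ Qᵇ z) Qᵇ⊥z _ (from (image⇔ bits Q _) (x , Qx , refl)) ⟩
        false                                ∎) , ec))
    (λ im → let c , Dc , ec = to (image⇔ bits′ D z) im in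
      from (dual₂⇔ Qᵇ z) λ u Qᵇu → let x , Qx , ex = to (image⇔ bits Q u) Qᵇu in begin
        dot₂ u z                              ≡⟨ cong₂ dot₂ ex ec ⟨
        dot₂ (encode bits x) (encode bits′ c) ≡⟨ traceIP≡dot-bits x c ⟨
        traceIP x c                           ≡⟨ to (dual₄⇔ Q c) Dc x Qx ⟩
        false                                 ∎)
    where open ≡-Reasoning

  card-dual₄ : IsAdditive Q → card₄ Q * card₄ (dual₄ Q) ≡ 2 ^ (n * 2)
  card-dual₄ addQ = begin
    card₄ Q * card₄ D                 ≡⟨ cong₂ _*_ (card-image bits bits-injective bits-blocks Q)
                                                   (card-image bits′ bits′-injective bits′-blocks D) ⟨
    card₂ Qᵇ * card₂ (image bits′ D)  ≡⟨ cong (card₂ Qᵇ *_) (count-cong dual-Qᵇ (allVecs Bool-elems (n * 2))) ⟨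
    card₂ Qᵇ * card₂ (dual₂ Qᵇ)       ≡⟨ card-dual₂ Qᵇ (image-linear bits bits-⊕ refl Q addQ) ⟩
    2 ^ (n * 2)                       ∎
    where open ≡-Reasoning

  dual₄-dual₄-⊆ : IsAdditive Q → ∀ x → dual₄ (dual₄ Q) x ≡ true → Q x ≡ true
  dual₄-dual₄-⊆ addQ x D⊥x =
    let y , Qy , ey = to (image⇔ bits Q _)
          (dual₂-dual₂-⊆ Qᵇ (image-linear bits bits-⊕ refl Q addQ) (encode bits x)
            (from (dual₂⇔ (dual₂ Qᵇ) _) orth))
    in subst (λ x → Q x ≡ true) (encode-injective bits bits-injective ey) Qy
    where
    open ≡-Reasoning
    orth : ∀ v → dual₂ Qᵇ v ≡ true → dot₂ v (encode bits x) ≡ false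
    orth v Qᵇ⊥v = let c , Dc , ec = to (image⇔ bits′ D v) (trans (sym (dual-Qᵇ v)) Qᵇ⊥v) in begin
      dot₂ v (encode bits x)                 ≡⟨ cong (λ w → dot₂ w _) ec ⟨
      dot₂ (encode bits′ c) (encode bits x)  ≡⟨ dot-comm _ (encode bits x) ⟩
      dot₂ (encode bits x) (encode bits′ c)  ≡⟨ traceIP≡dot-bits x c ⟨
      traceIP x c                            ≡⟨ traceIP-comm x c ⟩
      traceIP c x                            ≡⟨ to (dual₄⇔ D x) D⊥x c Dc ⟩
      false                                  ∎

φ⁻¹ : Vec Bool 3 → F4
φ⁻¹ (b ∷ _ ∷ a ∷ []) = fromPair a b

φ-injective : Injective _≡_ _≡_ φ
φ-injective = inverseʳ⇒injective {f⁻¹ = φ⁻¹} φ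
  (strictlyInverseʳ⇒inverseʳ {f⁻¹ = φ⁻¹} φ λ { 𝟎 → refl ; 𝟏 → refl ; ω → refl ; ω² → refl })

φ-⊕ : ∀ a b → φ (a +₄ b) ≡ φ a ⊕₂ φ b
φ-⊕ 𝟎  = λ { 𝟎 → refl ; 𝟏 → refl ; ω → refl ; ω² → refl }
φ-⊕ 𝟏  = λ { 𝟎 → refl ; 𝟏 → refl ; ω → refl ; ω² → refl }
φ-⊕ ω  = λ { 𝟎 → refl ; 𝟏 → refl ; ω → refl ; ω² → refl }
φ-⊕ ω² = λ { 𝟎 → refl ; 𝟏 → refl ; ω → refl ; ω² → refl }

-- φ(F₄) is the even-weight part of F₂³.
φ-blocks : BlockSum φ
φ-blocks G outside
  rewrite outside (false ∷ false ∷ true ∷ []) (λ { 𝟎 () ; 𝟏 () ; ω () ; ω² () })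
        | outside (false ∷ true ∷ false ∷ []) (λ { 𝟎 () ; 𝟏 () ; ω () ; ω² () })
        | outside (true ∷ false ∷ false ∷ []) (λ { 𝟎 () ; 𝟏 () ; ω () ; ω² () })
        | outside (true ∷ true ∷ true ∷ [])   (λ { 𝟎 () ; 𝟏 () ; ω () ; ω² () })
  = cong (λ s → G (φ 𝟎) + (G (φ 𝟏) + s)) (x∙yz≈y∙xz (G (φ ω²)) (G (φ ω)) 0)

wt-φ : (y : Vec F4 n) → wt₂ (encode φ y) ≡ 2 * wt₄ y
wt-φ []       = refl
wt-φ (𝟎 ∷ y)  = wt-φ y
wt-φ (𝟏 ∷ y)  = trans (cong (2 +_) (wt-φ y)) (sym (*-suc 2 (wt₄ y)))
wt-φ (ω ∷ y)  = trans (cong (2 +_) (wt-φ y)) (sym (*-suc 2 (wt₄ y)))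
wt-φ (ω² ∷ y) = trans (cong (2 +_) (wt-φ y)) (sym (*-suc 2 (wt₄ y)))

2*-≡ᵇ : ∀ a b → (2 * a ≡ᵇ 2 * b) ≡ (a ≡ᵇ b)
2*-≡ᵇ a b = ≡-from-⇔
  (λ e → to T-≡ (≡⇒≡ᵇ a b (*-cancelˡ-≡ a b 2 (≡ᵇ⇒≡ (2 * a) (2 * b) (from T-≡ e)))))
  (λ e → to T-≡ (≡⇒≡ᵇ (2 * a) (2 * b) (cong (2 *_) (≡ᵇ⇒≡ a b (from T-≡ e)))))

module BinaryImage {n : ℕ} (Q : Code₄ n) (addQ : IsAdditive Q) where

  private
    D = dual₄ Q
    P = imageφ D
    B = dual₂ P

  P-linear : IsLinear₂ P
  P-linear = image-linear φ φ-⊕ refl D (dual₄-additive Q)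

  card-B : ∀ m → card₄ Q ≡ 2 ^ m → card₂ B ≡ 2 ^ (n + m)
  card-B m cardQ = *-cancelˡ-≡ (card₂ B) (2 ^ (n + m)) (2 ^ (n * 2)) {{m^n≢0 2 (n * 2)}} (begin
    2 ^ (n * 2) * card₂ B           ≡⟨ cong (_* card₂ B) |Q||D| ⟨
    2 ^ m * card₄ D * card₂ B       ≡⟨ *-assoc (2 ^ m) (card₄ D) (card₂ B) ⟩
    2 ^ m * (card₄ D * card₂ B)     ≡⟨ cong (λ k → 2 ^ m * (k * card₂ B)) (card-image φ φ-injective φ-blocks D) ⟨
    2 ^ m * (card₂ P * card₂ B)     ≡⟨ cong (2 ^ m *_) (card-dual₂ P P-linear) ⟩
    2 ^ m * 2 ^ (n * 3)             ≡⟨ ^-distribˡ-+-* 2 m (n * 3) ⟨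
    2 ^ (m + n * 3)                 ≡⟨ cong (2 ^_) (exponents n m) ⟩
    2 ^ (n * 2 + (n + m))           ≡⟨ ^-distribˡ-+-* 2 (n * 2) (n + m) ⟩
    2 ^ (n * 2) * 2 ^ (n + m)       ∎)
    where
    open ≡-Reasoning
    |Q||D| : 2 ^ m * card₄ D ≡ 2 ^ (n * 2)
    |Q||D| = trans (cong (_* card₄ D) (sym cardQ)) (QuaternaryDuality.card-dual₄ Q addQ)
    exponents : ∀ n m → m + n * 3 ≡ n * 2 + (n + m)
    exponents = solve-∀

  freq-B⊥ : ∀ v → freq₂ (dual₂ B) v ≡ countᵇ (λ y → D y ∧ (2 * wt₄ y ≡ᵇ v)) (allVecs F4-elems n)
  freq-B⊥ v = begin
    freq₂ (dual₂ B) v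
      ≡⟨ count-cong (λ z → cong (_∧ (wt₂ z ≡ᵇ v)) (dual₂-dual₂ P P-linear z)) (allVecs Bool-elems (n * 3)) ⟩
    countᵇ (λ z → P z ∧ (wt₂ z ≡ᵇ v)) (allVecs Bool-elems (n * 3))
      ≡⟨ count-image φ φ-injective φ-blocks n D (λ z → wt₂ z ≡ᵇ v) ⟩
    countᵇ (λ y → D y ∧ (wt₂ (encode φ y) ≡ᵇ v)) (allVecs F4-elems n)
      ≡⟨ count-cong (λ y → cong (λ k → D y ∧ (k ≡ᵇ v)) (wt-φ y)) (allVecs F4-elems n) ⟩
    countᵇ (λ y → D y ∧ (2 * wt₄ y ≡ᵇ v)) (allVecs F4-elems n) ∎
    where open ≡-Reasoning

  freq-double : ∀ w → freq₂ (dual₂ B) (2 * w) ≡ freq₄ D w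
  freq-double w = trans (freq-B⊥ (2 * w)) (count-cong (λ y → cong (D y ∧_) (2*-≡ᵇ (wt₄ y) w)) (allVecs F4-elems n))

  freq-even : ∀ v → freq₂ (dual₂ B) v ≢ 0 → ∃ λ w → v ≡ 2 * w × freq₄ D w ≢ 0
  freq-even v freq≢0 =
    let y , hit = count≢0⇒witness _ (allVecs F4-elems n) (λ c≡0 → freq≢0 (trans (freq-B⊥ v) c≡0))
        Dy , wt≡ = to ∧⇔ hit
    in wt₄ y , sym (≡ᵇ⇒≡ _ v (from T-≡ wt≡)) ,
       witness⇒count≢0 (λ x → D x ∧ (wt₄ x ≡ᵇ wt₄ y)) (allVecs-complete F4-complete y)
                       (from ∧⇔ (Dy , to T-≡ (≡⇒≡ᵇ (wt₄ y) (wt₄ y) refl)))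

ψ : F4 → Vec Bool 3
ψ 𝟎  = false ∷ false ∷ false ∷ []
ψ 𝟏  = true  ∷ false ∷ false ∷ []
ψ ω  = false ∷ false ∷ true  ∷ []
ψ ω² = false ∷ true  ∷ false ∷ []

φᵀ : Vec Bool 3 → F4
φᵀ (t₁ ∷ t₂ ∷ t₃ ∷ []) = fromPair (t₁ xor t₂) (t₂ xor t₃)

φ-adjoint : ∀ t c → dot₂ (φ c) t ≡ tp (φᵀ t) c
φ-adjoint (false ∷ false ∷ false ∷ []) = λ { 𝟎 → refl ; 𝟏 → refl ; ω → refl ; ω² → refl }
φ-adjoint (false ∷ false ∷ true  ∷ []) = λ { 𝟎 → refl ; 𝟏 → refl ; ω → refl ; ω² → refl }
φ-adjoint (false ∷ true  ∷ false ∷ []) = λ { 𝟎 → refl ; 𝟏 → refl ; ω → refl ; ω² → refl }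
φ-adjoint (false ∷ true  ∷ true  ∷ []) = λ { 𝟎 → refl ; 𝟏 → refl ; ω → refl ; ω² → refl }
φ-adjoint (true  ∷ false ∷ false ∷ []) = λ { 𝟎 → refl ; 𝟏 → refl ; ω → refl ; ω² → refl }
φ-adjoint (true  ∷ false ∷ true  ∷ []) = λ { 𝟎 → refl ; 𝟏 → refl ; ω → refl ; ω² → refl }
φ-adjoint (true  ∷ true  ∷ false ∷ []) = λ { 𝟎 → refl ; 𝟏 → refl ; ω → refl ; ω² → refl }
φ-adjoint (true  ∷ true  ∷ true  ∷ []) = λ { 𝟎 → refl ; 𝟏 → refl ; ω → refl ; ω² → refl }

φᵀᵛ : Vec Bool (n * 3) → Vec F4 n
φᵀᵛ {zero}  []                   = []
φᵀᵛ {suc n} (t₁ ∷ t₂ ∷ t₃ ∷ z) = φᵀ (t₁ ∷ t₂ ∷ t₃ ∷ []) ∷ φᵀᵛ z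

φᵀ-ψ : (x : Vec F4 n) → φᵀᵛ (encode ψ x) ≡ x
φᵀ-ψ []       = refl
φᵀ-ψ (𝟎 ∷ x)  = cong (𝟎 ∷_) (φᵀ-ψ x)
φᵀ-ψ (𝟏 ∷ x)  = cong (𝟏 ∷_) (φᵀ-ψ x)
φᵀ-ψ (ω ∷ x)  = cong (ω ∷_) (φᵀ-ψ x)
φᵀ-ψ (ω² ∷ x) = cong (ω² ∷_) (φᵀ-ψ x)

ψ-φᵀ-light : (z : Vec Bool (n * 3)) → wt₂ z ≤ 1 → encode ψ (φᵀᵛ {n} z) ≡ z
ψ-φᵀ-light {zero}  []                          _         = refl
ψ-φᵀ-light {suc n} (false ∷ false ∷ false ∷ z) light     = cong (ψ 𝟎 ++_) (ψ-φᵀ-light {n} z light)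
ψ-φᵀ-light {suc n} (false ∷ false ∷ true  ∷ z) (s≤s z≤0) = cong (ψ ω ++_) (ψ-φᵀ-light {n} z (m≤n⇒m≤1+n z≤0))
ψ-φᵀ-light {suc n} (false ∷ true  ∷ false ∷ z) (s≤s z≤0) = cong (ψ ω² ++_) (ψ-φᵀ-light {n} z (m≤n⇒m≤1+n z≤0))
ψ-φᵀ-light {suc n} (true  ∷ false ∷ false ∷ z) (s≤s z≤0) = cong (ψ 𝟏 ++_) (ψ-φᵀ-light {n} z (m≤n⇒m≤1+n z≤0))
ψ-φᵀ-light {suc n} (false ∷ true  ∷ true  ∷ z) (s≤s ())
ψ-φᵀ-light {suc n} (true  ∷ false ∷ true  ∷ z) (s≤s ())
ψ-φᵀ-light {suc n} (true  ∷ true  ∷ _     ∷ z) (s≤s ())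

wt-ψ : (x : Vec F4 n) → wt₂ (encode ψ x) ≡ wt₄ x
wt-ψ []       = refl
wt-ψ (𝟎 ∷ x)  = wt-ψ x
wt-ψ (𝟏 ∷ x)  = cong suc (wt-ψ x)
wt-ψ (ω ∷ x)  = cong suc (wt-ψ x)
wt-ψ (ω² ∷ x) = cong suc (wt-ψ x)

record Represents (z : Vec Bool (n * 3)) (x : Vec F4 n) : Set where
  constructor represents
  field pairing : (c : Vec F4 n) → dot₂ (encode φ c) z ≡ traceIP x c

open Represents

represents-φᵀ : (z : Vec Bool (n * 3)) → Represents z (φᵀᵛ {n} z)
represents-φᵀ z = represents (pairing-φᵀ z)
  where
  pairing-φᵀ : ∀ {n} (z : Vec Bool (n * 3)) (c : Vec F4 n) → dot₂ (encode φ c) z ≡ traceIP (φᵀᵛ z) c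
  pairing-φᵀ {zero}  []                   []       = refl
  pairing-φᵀ {suc n} (t₁ ∷ t₂ ∷ t₃ ∷ z) (c ∷ cs) =
    trans (dot-++ (φ c) (t₁ ∷ t₂ ∷ t₃ ∷ []) (encode φ cs) z) (cong₂ _xor_ (φ-adjoint _ c) (pairing-φᵀ z cs))

represents-ψ : (x : Vec F4 n) → Represents (encode ψ x) x
represents-ψ x = subst (Represents (encode ψ x)) (φᵀ-ψ x) (represents-φᵀ (encode ψ x))

represents-⊕ : {z z′ : Vec Bool (n * 3)} {x x′ : Vec F4 n} →
               Represents z x → Represents z′ x′ → Represents (z ⊕₂ z′) (x ⊕₄ x′)
represents-⊕ {z = z} {z′} {x} {x′} r r′ = represents λ c →
  trans (dot-⊕ʳ (encode φ c) z z′) (trans (cong₂ _xor_ (pairing r c) (pairing r′ c)) (sym (traceIP-⊕ˡ x x′ c)))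

⊕₄-self : (x : Vec F4 n) → x ⊕₄ x ≡ replicate n 𝟎
⊕₄-self []       = refl
⊕₄-self (𝟎 ∷ x)  = cong (𝟎 ∷_) (⊕₄-self x)
⊕₄-self (𝟏 ∷ x)  = cong (𝟎 ∷_) (⊕₄-self x)
⊕₄-self (ω ∷ x)  = cong (𝟎 ∷_) (⊕₄-self x)
⊕₄-self (ω² ∷ x) = cong (𝟎 ∷_) (⊕₄-self x)

module CosetGraphs {n : ℕ} (Q : Code₄ n) (addQ : IsAdditive Q) where

  private
    D = dual₄ Q
    B = dual₂ (imageφ D)

  B-represents : {z : Vec Bool (n * 3)} {x : Vec F4 n} → Represents z x → B z ≡ true ⇔ Q x ≡ true
  B-represents {z} {x} r = mk⇔
    (λ Bz → QuaternaryDuality.dual₄-dual₄-⊆ Q addQ x (from (dual₄⇔ D x) λ c Dc →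
      trans (traceIP-comm c x) (trans (sym (pairing r c)) (to (dual₂⇔ (imageφ D) z) Bz _ (from (image⇔ φ D _) (c , Dc , refl))))))
    (λ Qx → from (dual₂⇔ (imageφ D) z) λ w Pw → let c , Dc , ec = to (image⇔ φ D w) Pw in
      trans (cong (λ w → dot₂ w z) (sym ec)) (trans (pairing r c) (to (dual₄⇔ Q c) Dc x Qx)))

  iso : cosetGraph₄ Q ≅ᴳ cosetGraph₂ B
  iso = record
    { f      = encode ψ
    ; f-wd   = λ x y → from (B-represents (represents-sum x y))
    ; f-inj  = λ x y → to (B-represents (represents-sum x y))
    ; f-surj = λ z → φᵀᵛ {n} z , from (B-represents (represents-⊕ (represents-ψ (φᵀᵛ z)) (represents-φᵀ z)))
                               (subst (λ x → Q x ≡ true) (sym (⊕₄-self (φᵀᵛ z))) (proj₁ addQ))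
    ; f-adj  = λ x y → mk⇔
        (λ (e , wt≡1 , Q∋) → encode ψ e , trans (wt-ψ e) wt≡1 ,
                             from (B-represents (represents-⊕ (represents-sum x y) (represents-ψ e))) Q∋)
        (λ (e , wt≡1 , B∋) → φᵀᵛ e ,
                             trans (sym (wt-ψ (φᵀᵛ {n} e))) (trans (cong wt₂ (ψ-φᵀ-light {n} e (≤-reflexive wt≡1))) wt≡1) ,
                             to (B-represents (represents-⊕ (represents-sum x y) (represents-φᵀ e))) B∋)
    }
    where
    represents-sum : (x y : Vec F4 n) → Represents (encode ψ x ⊕₂ encode ψ y) (x ⊕₄ y)
    represents-sum x y = represents-⊕ (represents-ψ x) (represents-ψ y)

theorem6 : (n m : ℕ) (Q : Code₄ n) → IsAdditive Q → card₄ Q ≡ 2 ^ m →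
    (IsLinear₂ (dual₂ (imageφ (dual₄ Q))) × card₂ (dual₂ (imageφ (dual₄ Q))) ≡ 2 ^ (n + m))
    × ((∀ w → freq₂ (dual₂ (dual₂ (imageφ (dual₄ Q)))) (2 * w) ≡ freq₄ (dual₄ Q) w)
       × (∀ v → freq₂ (dual₂ (dual₂ (imageφ (dual₄ Q)))) v ≢ 0 → ∃ (λ w → (v ≡ 2 * w) × (freq₄ (dual₄ Q) w ≢ 0))))
    × (cosetGraph₄ Q ≅ᴳ cosetGraph₂ (dual₂ (imageφ (dual₄ Q))))
theorem6 n m Q addQ cardQ =
  (dual₂-linear _ , card-B m cardQ) , (freq-double , freq-even) , CosetGraphs.iso Q addQ
  where open BinaryImage Q addQ
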